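{- If $n$ is an odd integer with $n\geq 3$, then $\dim_f(K_2\Box C_n)=\frac{2n}{n+1}$.
   Context: $K_2$ is the complete graph on two vertices and $C_n$ the cycle on $n$ vertices. The cartesian product $G\Box H$ has vertex set $V(G)\times V(H)$, with $(u_1,v_1)$ adjacent to $(u_2,v_2)$ iff either $u_1=u_2$ and $v_1v_2\in E(H)$, or $v_1=v_2$ and $u_1u_2\in E(G)$. For vertices $x,y$ of a connected graph $G$, $R_G\{x,y\}$ is the set of vertices $z$ with $d_G(x,z)\neq d_G(y,z)$. A resolving function of $G$ is $f:V(G)\to[0,1]$ with $\sum_{z\in R_G\{x,y\}}f(z)\geq 1$ for all distinct $x,y$; $\dim_f(G)$ is the minimum of $\sum_{v\in V(G)}f(v)$ over all resolving functions $f$. -}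

module Defs where

open import Data.Bool using (Bool; true; false; not; _∧_; _∨_; T)
open import Data.Nat using (ℕ; zero; suc)
open import Data.Nat.Properties using () renaming (_≟_ to _≟ℕ_)
open import Data.Fin using (Fin; toℕ)
open import Data.Fin.Properties using () renaming (_≟_ to _≟F_)
open import Data.List using (List; length; filter; upTo; allFin; cartesianProduct; foldr; map)
open import Data.Bool.ListAction using (any)
open import Data.Bool.Properties using (T?)
open import Data.Product using (Σ; _×_; _,_)
open import Data.Rational using (ℚ; 0ℚ; 1ℚ; _+_; _≤_)
open import Relation.Nullary using (¬_)
open import Relation.Nullary.Decidable using (⌊_⌋; ¬?)
open import Relation.Binary.PropositionalEquality using (_≡_)

-- A finite simple graph: a vertex type with a complete duplicate-free
-- enumeration 'verts', decidable equality 'eq?' and a symmetric,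
-- irreflexive adjacency 'adj'.
record FinGraph : Set₁ where
  field
    Vert  : Set
    verts : List Vert
    eq?   : Vert → Vert → Bool
    adj   : Vert → Vert → Bool
open FinGraph public

K₂ : FinGraph
K₂ = record
  { Vert = Fin 2 ; verts = allFin 2
  ; eq? = λ i j → ⌊ i ≟F j ⌋
  ; adj = λ i j → not ⌊ i ≟F j ⌋ }

-- cycle Cₙ on vertices 0,…,n-1 (intended for n ≥ 3):
-- i ~ j iff j = i+1, i = j+1, or {i,j} = {0,n-1}
C : ℕ → FinGraph
C n = record
  { Vert = Fin n ; verts = allFin n
  ; eq? = λ i j → ⌊ i ≟F j ⌋
  ; adj = λ i j → ⌊ toℕ j ≟ℕ suc (toℕ i) ⌋ ∨ ⌊ toℕ i ≟ℕ suc (toℕ j) ⌋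
                ∨ (⌊ toℕ i ≟ℕ 0 ⌋ ∧ ⌊ suc (toℕ j) ≟ℕ n ⌋)
                ∨ (⌊ toℕ j ≟ℕ 0 ⌋ ∧ ⌊ suc (toℕ i) ≟ℕ n ⌋) }

_□_ : FinGraph → FinGraph → FinGraph
G □ H = record
  { Vert = Vert G × Vert H
  ; verts = cartesianProduct (verts G) (verts H)
  ; eq? = λ { (u₁ , v₁) (u₂ , v₂) → eq? G u₁ u₂ ∧ eq? H v₁ v₂ }
  ; adj = λ { (u₁ , v₁) (u₂ , v₂) →
        (eq? G u₁ u₂ ∧ adj H v₁ v₂) ∨ (eq? H v₁ v₂ ∧ adj G u₁ u₂) } }

reachWithin : (G : FinGraph) → ℕ → Vert G → Vert G → Bool
reachWithin G zero    x y = eq? G x y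
reachWithin G (suc k) x y =
  reachWithin G k x y ∨ any (λ z → reachWithin G k x z ∧ adj G z y) (verts G)

-- graph distance d_G(x,y) in a connected graph: the least k with
-- reachWithin G k x y (computed as the number of k < |V(G)| for which
-- y is not yet reachable within k steps; reachability is monotone in k
-- and in a connected graph d(x,y) < |V(G)|).
dist : (G : FinGraph) → Vert G → Vert G → ℕ
dist G x y = length (filter (λ k → ¬? (T? (reachWithin G k x y))) (upTo (length (verts G))))

sumℚ : {A : Set} → (A → ℚ) → List A → ℚ
sumℚ f = foldr (λ a s → f a + s) 0ℚ

weightR : (G : FinGraph) → (Vert G → ℚ) → Vert G → Vert G → ℚ
weightR G f x y =
  sumℚ f (filter (λ z → ¬? (dist G x z ≟ℕ dist G y z)) (verts G))

IsResolvingFunction : (G : FinGraph) → (Vert G → ℚ) → Set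
IsResolvingFunction G f =
  ((v : Vert G) → (0ℚ ≤ f v) × (f v ≤ 1ℚ)) ×
  ((x y : Vert G) → ¬ (x ≡ y) → 1ℚ ≤ weightR G f x y)

totalWeight : (G : FinGraph) → (Vert G → ℚ) → ℚ
totalWeight G f = sumℚ f (verts G)

FracMetricDim≡ : FinGraph → ℚ → Set
FracMetricDim≡ G q =
  (Σ (Vert G → ℚ) λ f → IsResolvingFunction G f × (totalWeight G f ≡ q)) ×
  ((f : Vert G → ℚ) → IsResolvingFunction G f → q ≤ totalWeight G f)

{-# OPTIONS --safe #-}

-- Write n = 2m + 1. The vertex (a , i) of K₂ □ Cₙ lies in layer a at position i of the cycle, and its
-- distance to (b , j) is [a ≠ b] + d(i , j) with d the distance in Cₙ. Upper bound: the constant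
-- function 1/(n + 1) resolves, since every pair is resolved by at least n + 1 vertices. Two vertices
-- in different layers are resolved, in every column w, by (a , w) or by (b , w), and by both when w
-- is equidistant from i and j, which exists because n is odd. Two vertices (a , i), (a , j) of one
-- layer are resolved in each layer by all but the unique point of the odd cycle equidistant from i and
-- j, which gives 2n − 2 ≥ n + 1 vertices as n ≥ 3. Lower bound: each of the n pairs (0 , j), (1 , j + 1)
-- needs weight at least 1, while a vertex resolves at most m + 1 of these pairs, so double counting
-- gives (m + 1) · |f| ≥ n, that is |f| ≥ 2n / (n + 1).

module Submission where

open import Defs
open import Data.Nat using (ℕ)

module Counting where

  open import Data.Nat
  open import Data.Nat.Properties
  open import Data.List using (List; []; _∷_; length; filter; map; _++_; upTo; applyUpTo)
  open import Data.List.Properties using (length-++; map-upTo; filter-++; filter-all; filter-none; filter-some)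
  open import Data.List.Relation.Unary.All as All using (All; []; _∷_)
  open import Data.List.Relation.Unary.Any using (Any)
  open import Data.List.Relation.Unary.AllPairs using ([]; _∷_)
  open import Data.List.Relation.Unary.Unique.Propositional using (Unique)
  import Data.List.Relation.Unary.Unique.Propositional.Properties as Unique
  open import Data.List.Relation.Unary.All.Properties using (all-filter)
  open import Data.Product using (_,_; proj₂)
  open import Data.Sum using (inj₁; inj₂)
  open import Function using (_∘_)
  open import Level using (0ℓ)
  open import Relation.Nullary using (yes; no; ¬_; contradiction)
  open import Relation.Nullary.Decidable using (toSum)
  open import Relation.Unary using (Pred; Decidable; _⊆_; _∪_; _∩_; ∁)
  open import Relation.Unary.Properties using (_∪?_; _∩?_; ∁?; U?)
  open import Relation.Binary.PropositionalEquality using (_≡_; refl; sym; trans; cong; module ≡-Reasoning)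
  open import Data.Unit using (tt)

  count : {A : Set} {P : Pred A 0ℓ} → Decidable P → List A → ℕ
  count P? xs = length (filter P? xs)

  module _ {A : Set} where

    module _ {P : Pred A 0ℓ} (P? : Decidable P) where

      count-++ : ∀ xs ys → count P? (xs ++ ys) ≡ count P? xs + count P? ys
      count-++ xs ys = trans (cong length (filter-++ P? xs ys)) (length-++ (filter P? xs))

      count-map : {B : Set} (f : B → A) (xs : List B) → count P? (map f xs) ≡ count (λ y → P? (f y)) xs
      count-map f [] = refl
      count-map f (x ∷ xs) with P? (f x)
      ... | yes _ = cong suc (count-map f xs)
      ... | no _ = count-map f xs

      count-all : ∀ {xs} → All P xs → count P? xs ≡ length xs
      count-all all = cong length (filter-all P? all)

      count-mono : ∀ {Q : Pred A 0ℓ} (Q? : Decidable Q) → P ⊆ Q → ∀ xs → count P? xs ≤ count Q? xs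
      count-mono Q? P⊆Q [] = z≤n
      count-mono Q? P⊆Q (x ∷ xs) with P? x | Q? x
      ... | yes _ | yes _ = s≤s (count-mono Q? P⊆Q xs)
      ... | yes p | no ¬q = contradiction (P⊆Q p) ¬q
      ... | no _ | yes _ = m≤n⇒m≤1+n (count-mono Q? P⊆Q xs)
      ... | no _ | no _ = count-mono Q? P⊆Q xs

      count-none : ∀ {xs} → All (∁ P) xs → count P? xs ≡ 0
      count-none none = cong length (filter-none P? none)

      count-≤1 : ∀ {xs} → Unique xs → (∀ {x y} → P x → P y → x ≡ y) → count P? xs ≤ 1
      count-≤1 {xs} unique same = length≤1 (Unique.filter⁺ P? unique) (all-filter P? xs)
        where
        length≤1 : ∀ {ys} → Unique ys → All P ys → length ys ≤ 1
        length≤1 [] [] = z≤n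
        length≤1 (_ ∷ []) _ = ≤-refl
        length≤1 ((x≢y ∷ _) ∷ _) (px ∷ py ∷ _) = contradiction (same px py) x≢y

    module _ {P Q : Pred A 0ℓ} (P? : Decidable P) (Q? : Decidable Q) where

      count-∪-∩ : ∀ xs → count P? xs + count Q? xs ≡ count (P? ∪? Q?) xs + count (P? ∩? Q?) xs
      count-∪-∩ [] = refl
      count-∪-∩ (x ∷ xs) with P? x | Q? x | count-∪-∩ xs
      ... | yes _ | yes _ | ih = cong suc (trans (+-suc _ _) (trans (cong suc ih) (sym (+-suc _ _))))
      ... | yes _ | no _ | ih = cong suc ih
      ... | no _ | yes _ | ih = trans (+-suc _ _) (cong suc ih)
      ... | no _ | no _ | ih = ih

      count-≤-+ : ∀ {R : Pred A 0ℓ} (R? : Decidable R) → R ⊆ P ∪ Q → ∀ xs →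
                  count R? xs ≤ count P? xs + count Q? xs
      count-≤-+ R? R⊆P∪Q xs = begin
        count R? xs                                 ≤⟨ count-mono R? (P? ∪? Q?) R⊆P∪Q xs ⟩
        count (P? ∪? Q?) xs                         ≤⟨ m≤m+n _ _ ⟩
        count (P? ∪? Q?) xs + count (P? ∩? Q?) xs   ≡⟨ sym (count-∪-∩ xs) ⟩
        count P? xs + count Q? xs                   ∎
        where open ≤-Reasoning

      count-cover-overlap : ∀ {xs} → All (P ∪ Q) xs → Any (P ∩ Q) xs →
                            suc (length xs) ≤ count P? xs + count Q? xs
      count-cover-overlap {xs} cover shared = begin
        suc (length xs)                             ≡⟨ cong suc (sym (count-all (P? ∪? Q?) cover)) ⟩
        suc (count (P? ∪? Q?) xs)                   ≡⟨ +-comm 1 _ ⟩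
        count (P? ∪? Q?) xs + 1                     ≤⟨ +-monoʳ-≤ _ (filter-some (P? ∩? Q?) shared) ⟩
        count (P? ∪? Q?) xs + count (P? ∩? Q?) xs   ≡⟨ sym (count-∪-∩ xs) ⟩
        count P? xs + count Q? xs                   ∎
        where open ≤-Reasoning

    module _ {P : Pred A 0ℓ} (P? : Decidable P) where

      length≤1+count : ∀ {xs} → Unique xs → (∀ {x y} → ¬ P x → ¬ P y → x ≡ y) →
                       length xs ≤ suc (count P? xs)
      length≤1+count {xs} unique same = begin
        length xs                        ≡⟨ sym (count-all U? (All.universal (λ _ → tt) xs)) ⟩
        count U? xs                      ≤⟨ count-≤-+ P? (∁? P?) U? (λ {x} _ → toSum (P? x)) xs ⟩
        count P? xs + count (∁? P?) xs   ≤⟨ +-monoʳ-≤ _ (count-≤1 (∁? P?) unique same) ⟩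
        count P? xs + 1                  ≡⟨ +-comm _ 1 ⟩
        suc (count P? xs)                ∎
        where open ≤-Reasoning

    count-≤-injection : ∀ {P : Pred A 0ℓ} (P? : Decidable P) {xs} → Unique xs → (φ : A → ℕ) → ∀ K →
                        (∀ {x y} → P x → P y → φ x ≡ φ y → x ≡ y) →
                        (∀ {x} → P x → φ x < K) → count P? xs ≤ K
    count-≤-injection P? {xs} _ φ zero _ bound =
      ≤-reflexive (count-none P? (All.universal (λ _ px → n≮0 (bound px)) xs))
    count-≤-injection {P} P? {xs} unique φ (suc K) injective bound = begin
      count P? xs                      ≤⟨ count-≤-+ below? at? P? split xs ⟩
      count below? xs + count at? xs   ≤⟨ +-mono-≤ belowBound atBound ⟩
      K + 1                            ≡⟨ +-comm K 1 ⟩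
      suc K                            ∎
      where
      open ≤-Reasoning
      below? : Decidable (P ∩ (λ x → φ x < K))
      below? = P? ∩? (λ x → φ x <? K)
      at? : Decidable (P ∩ (λ x → φ x ≡ K))
      at? = P? ∩? (λ x → φ x ≟ K)
      split : P ⊆ (P ∩ (λ x → φ x < K)) ∪ (P ∩ (λ x → φ x ≡ K))
      split px with m≤n⇒m<n∨m≡n (≤-pred (bound px))
      ... | inj₁ φx<K = inj₁ (px , φx<K)
      ... | inj₂ φx≡K = inj₂ (px , φx≡K)
      belowBound : count below? xs ≤ K
      belowBound = count-≤-injection below? unique φ K (λ (px , _) (py , _) → injective px py) proj₂
      atBound : count at? xs ≤ 1
      atBound = count-≤1 at? unique λ (px , φx≡K) (py , φy≡K) → injective px py (trans φx≡K (sym φy≡K))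

  count-upTo : ∀ {P : Pred ℕ 0ℓ} (P? : Decidable P) {N d} → d ≤ N →
               (∀ {k} → P k → k < d) → (∀ {k} → k < d → P k) → count P? (upTo N) ≡ d
  count-upTo P? {N} {zero} _ below _ = count-none P? (All.universal (λ _ pk → n≮0 (below pk)) (upTo N))
  count-upTo P? {suc N} {suc d} (s≤s d≤N) below above with P? 0
  ... | no ¬p0 = contradiction (above z<s) ¬p0
  ... | yes _ = cong suc (begin
    count P? (applyUpTo suc N)        ≡⟨ cong (count P?) (sym (map-upTo suc N)) ⟩
    count P? (map suc (upTo N))       ≡⟨ count-map P? suc (upTo N) ⟩
    count (λ k → P? (suc k)) (upTo N) ≡⟨ count-upTo (λ k → P? (suc k)) d≤N (≤-pred ∘ below) (above ∘ s≤s) ⟩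
    d                                 ∎)
    where open ≡-Reasoning

module GraphDistance where

  open Counting
  open import Data.Nat hiding (eq?)
  open import Data.Nat.Properties hiding (eq?)
  open import Data.Bool using (T; _∧_)
  open import Data.Bool.Properties using (T-∨; T-∧; T?)
  open import Data.List using (length)
  open import Data.List.Relation.Unary.Any as Any using (Any)
  open import Data.List.Relation.Unary.Any.Properties using (any⁺; any⁻)
  open import Data.Product using (_×_; _,_)
  open import Data.Sum using (inj₁; inj₂)
  open import Function using (Equivalence)
  open import Relation.Nullary.Decidable using (¬?)
  open import Relation.Binary.PropositionalEquality using (_≡_)
  open Equivalence using (to; from)

  module DistanceCharacterisation
    (G : FinGraph) (D : Vert G → Vert G → ℕ)
    (eq⇒D≡0 : ∀ x y → T (eq? G x y) → D x y ≡ 0)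
    (D≡0⇒eq : ∀ x y → D x y ≡ 0 → T (eq? G x y))
    (D-adj : ∀ x y z → T (adj G y z) → D x z ≤ suc (D x y))
    (D-predecessor : ∀ x z k → D x z ≡ suc k → Any (λ y → T (adj G y z) × D x y ≡ k) (verts G))
    (D≤|V| : ∀ x y → D x y ≤ length (verts G))
    where

    reachWithin⇒D≤ : ∀ k {x y} → T (reachWithin G k x y) → D x y ≤ k
    reachWithin⇒D≤ zero {x} {y} r = ≤-reflexive (eq⇒D≡0 x y r)
    reachWithin⇒D≤ (suc k) {x} {y} r with to (T-∨ {reachWithin G k x y}) r
    ... | inj₁ r′ = m≤n⇒m≤1+n (reachWithin⇒D≤ k r′)
    ... | inj₂ r′ with Any.satisfied (any⁻ _ (verts G) r′)
    ... | z , r″ with to (T-∧ {reachWithin G k x z}) r″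
    ... | xz , zy = ≤-trans (D-adj x z y zy) (s≤s (reachWithin⇒D≤ k xz))

    D≤⇒reachWithin : ∀ k {x y} → D x y ≤ k → T (reachWithin G k x y)
    D≤⇒reachWithin zero {x} {y} D≤0 = D≡0⇒eq x y (n≤0⇒n≡0 D≤0)
    D≤⇒reachWithin (suc k) {x} {y} D≤k+1 with m≤n⇒m<n∨m≡n D≤k+1
    ... | inj₁ D<k+1 = from T-∨ (inj₁ (D≤⇒reachWithin k (≤-pred D<k+1)))
    ... | inj₂ D≡k+1 = from T-∨ (inj₂ (any⁺ _ (Any.map reachPredecessor (D-predecessor x y k D≡k+1))))
      where
      reachPredecessor : ∀ {z} → T (adj G z y) × D x z ≡ k → T (reachWithin G k x z ∧ adj G z y)
      reachPredecessor (zy , Dxz≡k) = from T-∧ (D≤⇒reachWithin k (≤-reflexive Dxz≡k) , zy)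

    dist≡D : ∀ x y → dist G x y ≡ D x y
    dist≡D x y = count-upTo (λ k → ¬? (T? (reachWithin G k x y))) (D≤|V| x y)
      (λ unreached → ≰⇒> (λ D≤k → unreached (D≤⇒reachWithin _ D≤k)))
      (λ k<D reached → <⇒≱ k<D (reachWithin⇒D≤ _ reached))

module CyclicShift (n : ℕ) where

  open import Data.Nat
  open import Data.Nat.Properties
  open import Algebra.Properties.CommutativeSemigroup +-commutativeSemigroup using (xy∙z≈xz∙y)
  open import Data.Product using (∃; _×_; _,_)
  open import Data.Sum using (_⊎_; inj₁; inj₂)
  open import Relation.Nullary using (yes; no)
  open import Relation.Nullary.Negation using (contradiction)
  open import Relation.Binary.PropositionalEquality
    using (_≡_; _≢_; refl; sym; trans; cong; subst; module ≡-Reasoning)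

  data Shift (a k b : ℕ) : Set where
    direct  : a + k ≡ b → Shift a k b
    wrapped : a + k ≡ b + n → Shift a k b

  <n⇒≢+n : ∀ {x} k → x < n → x ≢ k + n
  <n⇒≢+n k x<n x≡k+n = <⇒≱ x<n (subst (n ≤_) (sym x≡k+n) (m≤n+m n k))

  shift-zero : ∀ {a b} → a < n → Shift a 0 b → a ≡ b
  shift-zero {a} a<n (direct e) = trans (sym (+-identityʳ a)) e
  shift-zero {a} {b} a<n (wrapped e) = contradiction (trans (sym (+-identityʳ a)) e) (<n⇒≢+n b a<n)

  shift-unique-length : ∀ {a k l b} → k < n → l < n → Shift a k b → Shift a l b → k ≡ l
  shift-unique-length {a} _ _ (direct e) (direct f) = +-cancelˡ-≡ a _ _ (trans e (sym f))
  shift-unique-length {a} {k} _ l<n (direct e) (wrapped f) =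
    contradiction (+-cancelˡ-≡ a _ _ (trans f (trans (cong (_+ n) (sym e)) (+-assoc a k n)))) (<n⇒≢+n k l<n)
  shift-unique-length {a} {l = l} k<n _ (wrapped e) (direct f) =
    contradiction (+-cancelˡ-≡ a _ _ (trans e (trans (cong (_+ n) (sym f)) (+-assoc a l n)))) (<n⇒≢+n l k<n)
  shift-unique-length {a} _ _ (wrapped e) (wrapped f) = +-cancelˡ-≡ a _ _ (trans e (sym f))

  shift-unique-target : ∀ {a k b c} → b < n → c < n → Shift a k b → Shift a k c → b ≡ c
  shift-unique-target _ _ (direct e) (direct f) = trans (sym e) f
  shift-unique-target {c = c} b<n _ (direct e) (wrapped f) = contradiction (trans (sym e) f) (<n⇒≢+n c b<n)
  shift-unique-target {b = b} _ c<n (wrapped e) (direct f) = contradiction (trans (sym f) e) (<n⇒≢+n b c<n)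
  shift-unique-target {b = b} {c} _ _ (wrapped e) (wrapped f) = +-cancelʳ-≡ n b c (trans (sym e) f)

  shift-unique-source : ∀ {a c k b} → a < n → c < n → Shift a k b → Shift c k b → a ≡ c
  shift-unique-source {k = k} _ _ (direct e) (direct f) = +-cancelʳ-≡ k _ _ (trans e (sym f))
  shift-unique-source {a} {c} {k} _ c<n (direct e) (wrapped f) =
    contradiction (+-cancelʳ-≡ k c (a + n) (trans f (trans (cong (_+ n) (sym e)) (xy∙z≈xz∙y a k n))))
                  (<n⇒≢+n a c<n)
  shift-unique-source {a} {c} {k} a<n _ (wrapped e) (direct f) =
    contradiction (+-cancelʳ-≡ k a (c + n) (trans e (trans (cong (_+ n) (sym f)) (xy∙z≈xz∙y c k n))))
                  (<n⇒≢+n c a<n)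
  shift-unique-source {k = k} _ _ (wrapped e) (wrapped f) = +-cancelʳ-≡ k _ _ (trans e (sym f))

  private
    +-extend : ∀ a k l {x} → a + k ≡ x → a + (k + l) ≡ x + l
    +-extend a k l e = trans (sym (+-assoc a k l)) (cong (_+ l) e)

    +-extendWrapped : ∀ a k l {b} → a + k ≡ b + n → a + (k + l) ≡ b + l + n
    +-extendWrapped a k l {b} e = trans (+-extend a k l e) (xy∙z≈xz∙y b n l)

  shift-compose : ∀ {a b c k l} → a < n → k + l < n → Shift a k b → Shift b l c → Shift a (k + l) c
  shift-compose {a} {k = k} {l} _ _ (direct e) (direct f) = direct (trans (+-extend a k l e) f)
  shift-compose {a} {k = k} {l} _ _ (direct e) (wrapped f) = wrapped (trans (+-extend a k l e) f)
  shift-compose {a} {k = k} {l} _ _ (wrapped e) (direct f) = wrapped (trans (+-extendWrapped a k l e) (cong (_+ n) f))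
  shift-compose {a} {c = c} {k} {l} a<n k+l<n (wrapped e) (wrapped f) =
    contradiction (+-mono-< a<n k+l<n) (≤⇒≯ twoLaps)
    where
    twoLaps : n + n ≤ a + (k + l)
    twoLaps = subst (n + n ≤_) (sym (trans (+-extendWrapped a k l e) (cong (_+ n) f)))
                    (+-monoˡ-≤ n (m≤n+m n c))

  shift-exists : ∀ {a k} → a < n → k < n → ∃ λ b → b < n × Shift a k b
  shift-exists {a} {k} a<n k<n with a + k <? n
  ... | yes a+k<n = a + k , a+k<n , direct refl
  ... | no a+k≮n =
    a + k ∸ n , m<n+o⇒m∸n<o (a + k) n {{>-nonZero (≤-<-trans z≤n a<n)}} (+-mono-< a<n k<n)
              , wrapped (sym (m∸n+n≡m (≮⇒≥ a+k≮n)))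

  shift-cancel : ∀ {a b c k l} → c < n → Shift a k b → Shift a (k + l) c → Shift b l c
  shift-cancel {a} {k = k} {l} _ (direct e) (direct f) = direct (trans (sym (+-extend a k l e)) f)
  shift-cancel {a} {k = k} {l} _ (direct e) (wrapped f) = wrapped (trans (sym (+-extend a k l e)) f)
  shift-cancel {a} {b} {k = k} {l} c<n (wrapped e) (direct f) =
    contradiction (trans (sym f) (+-extendWrapped a k l e)) (<n⇒≢+n (b + l) c<n)
  shift-cancel {a} {k = k} {l} _ (wrapped e) (wrapped f) =
    direct (+-cancelʳ-≡ n _ _ (trans (sym (+-extendWrapped a k l e)) f))

  shift-split : ∀ {a c} k l → a < n → c < n → k < n → Shift a (k + l) c →
                ∃ λ b → b < n × Shift a k b × Shift b l c
  shift-split k l a<n c<n k<n s with shift-exists a<n k<n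
  ... | b , b<n , t = b , b<n , t , shift-cancel c<n t s

  shift-reverse : ∀ {a b k} → k ≤ n → Shift a k b → Shift b (n ∸ k) a
  shift-reverse {a} {b} {k} k≤n (direct e) = wrapped (begin
    b + (n ∸ k)       ≡⟨ cong (_+ (n ∸ k)) (sym e) ⟩
    a + k + (n ∸ k)   ≡⟨ +-assoc a k (n ∸ k) ⟩
    a + (k + (n ∸ k)) ≡⟨ cong (a +_) (m+[n∸m]≡n k≤n) ⟩
    a + n             ∎)
    where open ≡-Reasoning
  shift-reverse {a} {b} {k} k≤n (wrapped e) = direct (+-cancelʳ-≡ k _ _ (begin
    b + (n ∸ k) + k   ≡⟨ +-assoc b (n ∸ k) k ⟩
    b + (n ∸ k + k)   ≡⟨ cong (b +_) (m∸n+n≡m k≤n) ⟩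
    b + n             ≡⟨ sym e ⟩
    a + k             ∎))
    where open ≡-Reasoning

  clockwise : ℕ → ℕ → ℕ
  clockwise a b with a ≤? b
  ... | yes _ = b ∸ a
  ... | no _ = b + n ∸ a

  clockwise-shift : ∀ {a b} → a < n → Shift a (clockwise a b) b
  clockwise-shift {a} {b} a<n with a ≤? b
  ... | yes a≤b = direct (m+[n∸m]≡n a≤b)
  ... | no _ = wrapped (m+[n∸m]≡n (≤-trans (<⇒≤ a<n) (m≤n+m n b)))

  clockwise<n : ∀ a {b} → b < n → clockwise a b < n
  clockwise<n a {b} b<n with a ≤? b
  ... | yes _ = ≤-<-trans (m∸n≤m b a) b<n
  ... | no a≰b = m<n+o⇒m∸n<o (b + n) a {{>-nonZero (≤-<-trans z≤n b<n)}} (+-monoˡ-< n (≰⇒> a≰b))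

  shift⇒clockwise≡ : ∀ {a b k} → a < n → b < n → k < n → Shift a k b → clockwise a b ≡ k
  shift⇒clockwise≡ {a} a<n b<n k<n ab = shift-unique-length (clockwise<n a b<n) k<n (clockwise-shift a<n) ab

  clockwise-injectiveʳ : ∀ {a b c} → a < n → b < n → c < n → clockwise a b ≡ clockwise a c → b ≡ c
  clockwise-injectiveʳ a<n b<n c<n e =
    shift-unique-target b<n c<n (clockwise-shift a<n) (subst (λ k → Shift _ k _) (sym e) (clockwise-shift a<n))

  clockwise-injectiveˡ : ∀ {a b c} → a < n → b < n → clockwise a c ≡ clockwise b c → a ≡ b
  clockwise-injectiveˡ a<n b<n e =
    shift-unique-source a<n b<n (clockwise-shift a<n) (subst (λ k → Shift _ k _) (sym e) (clockwise-shift b<n))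

  shift-round-trip : ∀ {a b k l} → a < n → k < n → l < n → Shift a k b → Shift b l a →
                     k + l ≡ 0 ⊎ k + l ≡ n
  shift-round-trip {a} {k = zero} a<n _ l<n ab ba with shift-zero a<n ab
  ... | refl = inj₁ (shift-unique-length l<n (≤-<-trans z≤n a<n) ba (direct (+-identityʳ a)))
  shift-round-trip {k = suc k} {l} _ k<n l<n ab ba = inj₂ (begin
    suc k + l           ≡⟨ cong (suc k +_) (shift-unique-length l<n n∸k+1<n ba (shift-reverse k≤n ab)) ⟩
    suc k + (n ∸ suc k) ≡⟨ m+[n∸m]≡n k≤n ⟩
    n                   ∎)
    where
    open ≡-Reasoning
    k≤n : suc k ≤ n
    k≤n = <⇒≤ k<n
    n∸k+1<n : n ∸ suc k < n
    n∸k+1<n = ∸-monoʳ-< z<s k≤n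

  wrapped-step⇒≡0 : ∀ {a b} → a < n → a + 1 ≡ b + n → b ≡ 0
  wrapped-step⇒≡0 {b = zero} _ _ = refl
  wrapped-step⇒≡0 {a} {suc b} a<n e =
    contradiction a<n (≤⇒≯ (≤-pred (subst (suc n ≤_) (trans (sym e) (+-comm a 1)) (s≤s (m≤n+m n b)))))

module OddCycle (m : ℕ) where

  open import Data.Nat
  open import Data.Nat.Properties
  open import Data.Nat.Tactic.RingSolver using (solve-∀)
  open import Algebra.Properties.CommutativeSemigroup +-commutativeSemigroup using (interchange)
  open import Data.Product using (∃; _×_; _,_; proj₁)
  open import Data.Sum using (_⊎_; inj₁; inj₂; [_,_])
  open import Relation.Nullary using (yes; no)
  open import Relation.Nullary.Negation using (contradiction)
  open import Relation.Binary.PropositionalEquality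
    using (_≡_; _≢_; refl; sym; trans; cong; cong₂; subst; module ≡-Reasoning)
  open import Relation.Binary.Definitions using (tri<; tri≈; tri>)

  n : ℕ
  n = suc (m + m)

  open CyclicShift n public

  Arc : ℕ → ℕ → ℕ → Set
  Arc a k b = Shift a k b ⊎ Shift b k a

  ≤m⇒<n : ∀ {k} → k ≤ m → k < n
  ≤m⇒<n k≤m = s≤s (≤-trans k≤m (m≤m+n m m))

  double<n : ∀ {k} → k ≤ m → k + k < n
  double<n k≤m = s≤s (+-mono-≤ k≤m k≤m)

  m<n∸ : ∀ {k} → k ≤ m → m < n ∸ k
  m<n∸ {k} k≤m = ≤-trans (≤-reflexive (sym n∸m≡1+m)) (∸-monoʳ-≤ n k≤m)
    where
    n∸m≡1+m : n ∸ m ≡ suc m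
    n∸m≡1+m = trans (+-∸-assoc 1 (m≤m+n m m)) (cong suc (m+n∸m≡n m m))

  double≢n : ∀ x → x + x ≢ n
  double≢n x x+x≡n = even≢odd x m (begin
    x + (x + 0)   ≡⟨ cong (x +_) (+-identityʳ x) ⟩
    x + x         ≡⟨ x+x≡n ⟩
    suc (m + m)   ≡⟨ cong (λ y → suc (m + y)) (sym (+-identityʳ m)) ⟩
    suc (m + (m + 0)) ∎)
    where open ≡-Reasoning

  half≤m : ∀ {h} → h + h < n → h ≤ m
  half≤m {h} h+h<n with h ≤? m
  ... | yes h≤m = h≤m
  ... | no h≰m = contradiction (+-mono-< (≰⇒> h≰m) (≰⇒> h≰m)) (<⇒≱ h+h<n)

  double-injective : ∀ {k l} → k + k ≡ l + l → k ≡ l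
  double-injective {k} {l} e with <-cmp k l
  ... | tri< k<l _ _ = contradiction e (<⇒≢ (+-mono-< k<l k<l))
  ... | tri≈ _ k≡l _ = k≡l
  ... | tri> _ _ l<k = contradiction (sym e) (<⇒≢ (+-mono-< l<k l<k))

  evenOrOdd : ∀ s → ∃ λ h → s ≡ h + h ⊎ s ≡ suc (h + h)
  evenOrOdd zero = 0 , inj₁ refl
  evenOrOdd (suc s) with evenOrOdd s
  ... | h , inj₁ e = h , inj₂ (cong suc e)
  ... | h , inj₂ e = suc h , inj₁ (cong suc (trans e (sym (+-suc h h))))

  clockwise-far : ∀ {a b} → a < n → b < n → m < clockwise a b →
                  ∃ λ t → suc t ≤ m × Shift b (suc t) a
  clockwise-far {a} {b} a<n b<n m<s
    with n ∸ clockwise a b in e | shift-reverse (<⇒≤ (clockwise<n a b<n)) (clockwise-shift {a} {b} a<n)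
  ... | zero | _ = contradiction (m∸n≡0⇒m≤n e) (<⇒≱ (clockwise<n a b<n))
  ... | suc t | back = t , subst (_≤ m) e n∸s≤m , back
    where
    n∸s≤m : n ∸ clockwise a b ≤ m
    n∸s≤m = ≤-trans (∸-monoʳ-≤ n m<s) (≤-reflexive (m+n∸m≡n m m))

  cycleDist : ℕ → ℕ → ℕ
  cycleDist a b with clockwise a b ≤? m
  ... | yes _ = clockwise a b
  ... | no _ = clockwise b a

  cycleDist-cases : ∀ a b → (clockwise a b ≤ m × cycleDist a b ≡ clockwise a b)
                          ⊎ (m < clockwise a b × cycleDist a b ≡ clockwise b a)
  cycleDist-cases a b with clockwise a b ≤? m
  ... | yes s≤m = inj₁ (s≤m , refl)
  ... | no s≰m = inj₂ (≰⇒> s≰m , refl)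

  cycleDist-arc : ∀ {a b} → a < n → b < n → Arc a (cycleDist a b) b
  cycleDist-arc {a} {b} a<n b<n with cycleDist-cases a b
  ... | inj₁ (_ , e) = inj₁ (subst (λ k → Shift a k b) (sym e) (clockwise-shift a<n))
  ... | inj₂ (_ , e) = inj₂ (subst (λ k → Shift b k a) (sym e) (clockwise-shift b<n))

  cycleDist≤m : ∀ {a b} → a < n → b < n → cycleDist a b ≤ m
  cycleDist≤m {a} {b} a<n b<n with cycleDist-cases a b
  ... | inj₁ (s≤m , e) = subst (_≤ m) (sym e) s≤m
  ... | inj₂ (m<s , e) with clockwise-far a<n b<n m<s
  ... | t , t+1≤m , ba = subst (_≤ m) (sym (trans e (shift⇒clockwise≡ b<n a<n (≤m⇒<n t+1≤m) ba)))
                               t+1≤m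

  shift⇒cycleDist≡ : ∀ {a b k} → a < n → b < n → k ≤ m → Shift a k b → cycleDist a b ≡ k
  shift⇒cycleDist≡ {a} {b} a<n b<n k≤m ab with cycleDist-cases a b
  ... | inj₁ (_ , e) = trans e (shift⇒clockwise≡ a<n b<n (≤m⇒<n k≤m) ab)
  ... | inj₂ (m<s , _) =
    contradiction (subst (_≤ m) (sym (shift⇒clockwise≡ a<n b<n (≤m⇒<n k≤m) ab)) k≤m) (<⇒≱ m<s)

  reverseShift⇒cycleDist≡ : ∀ {a b k} → a < n → b < n → k ≤ m → Shift b k a → cycleDist a b ≡ k
  reverseShift⇒cycleDist≡ {a} {b} {zero} a<n b<n _ ba with shift-zero b<n ba
  ... | refl = shift⇒cycleDist≡ a<n a<n z≤n (direct (+-identityʳ a))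
  reverseShift⇒cycleDist≡ {a} {b} {suc k} a<n b<n k+1≤m ba with cycleDist-cases a b
  ... | inj₂ (_ , e) = trans e (shift⇒clockwise≡ b<n a<n (≤m⇒<n k+1≤m) ba)
  ... | inj₁ (s≤m , _) = contradiction (subst (_≤ m) s≡n∸k+1 s≤m) (<⇒≱ (m<n∸ k+1≤m))
    where
    s≡n∸k+1 : clockwise a b ≡ n ∸ suc k
    s≡n∸k+1 = shift⇒clockwise≡ a<n b<n (s≤s (m∸n≤m (m + m) k))
                                (shift-reverse (<⇒≤ (≤m⇒<n k+1≤m)) ba)

  cycleDist-refl : ∀ {a} → a < n → cycleDist a a ≡ 0
  cycleDist-refl {a} a<n = shift⇒cycleDist≡ a<n a<n z≤n (direct (+-identityʳ a))

  cycleDist≡0⇒≡ : ∀ {a b} → a < n → b < n → cycleDist a b ≡ 0 → a ≡ b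
  cycleDist≡0⇒≡ {a} {b} a<n b<n e with subst (λ k → Arc a k b) e (cycleDist-arc a<n b<n)
  ... | inj₁ ab = shift-zero a<n ab
  ... | inj₂ ba = sym (shift-zero b<n ba)

  cycleDist-≤-arc : ∀ {a b k} → a < n → b < n → Arc a k b → cycleDist a b ≤ k
  cycleDist-≤-arc {k = k} a<n b<n arc with k ≤? m
  ... | yes k≤m =
    ≤-reflexive ([ shift⇒cycleDist≡ a<n b<n k≤m , reverseShift⇒cycleDist≡ a<n b<n k≤m ] arc)
  ... | no k≰m = ≤-trans (cycleDist≤m a<n b<n) (<⇒≤ (≰⇒> k≰m))

  arc-extend : ∀ {u v w} k → u < n → v < n → w < n → suc k < n → Arc u k v → Arc v 1 w →
               ∃ λ l → l ≤ suc k × Arc u l w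
  arc-extend {u} {v} {w} k u<n _ _ k+1<n (inj₁ uv) (inj₁ vw) =
    suc k , ≤-refl , inj₁ (subst (λ l → Shift u l w) (+-comm k 1)
                             (shift-compose u<n (subst (_< n) (+-comm 1 k) k+1<n) uv vw))
  arc-extend k _ _ w<n k+1<n (inj₂ vu) (inj₂ wv) = suc k , ≤-refl , inj₂ (shift-compose w<n k+1<n wv vu)
  arc-extend zero _ v<n _ _ (inj₂ vu) (inj₁ vw) with shift-zero v<n vu
  ... | refl = 1 , ≤-refl , inj₁ vw
  arc-extend (suc k) u<n v<n w<n k+2<n (inj₂ vu) (inj₁ vw)
    with shift-split 1 k v<n u<n (≤-<-trans (s≤s z≤n) k+2<n) vu
  ... | b , b<n , vb , bu with shift-unique-target b<n w<n vb vw
  ... | refl = k , m≤n+m k 2 , inj₂ bu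
  arc-extend zero u<n _ _ _ (inj₁ uv) (inj₂ wv) with shift-zero u<n uv
  ... | refl = 1 , ≤-refl , inj₂ wv
  arc-extend {u} {v} (suc k) u<n v<n w<n k+2<n (inj₁ uv) (inj₂ wv)
    with shift-split k 1 u<n v<n (≤-<-trans (m≤n+m k 2) k+2<n) (subst (λ l → Shift u l v) (+-comm 1 k) uv)
  ... | b , b<n , ub , bv with shift-unique-source b<n w<n bv wv
  ... | refl = k , m≤n+m k 2 , inj₁ ub

  cycleDist-adj : ∀ {u v w} → u < n → v < n → w < n → Arc v 1 w → cycleDist u w ≤ suc (cycleDist u v)
  cycleDist-adj {u} {v} {w} u<n v<n w<n vw with suc (cycleDist u v) ≤? m
  ... | no k+1≰m = ≤-trans (cycleDist≤m u<n w<n) (<⇒≤ (≰⇒> k+1≰m))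
  ... | yes k+1≤m with arc-extend (cycleDist u v) u<n v<n w<n (≤m⇒<n k+1≤m) (cycleDist-arc u<n v<n) vw
  ... | l , l≤k+1 , uw = ≤-trans (cycleDist-≤-arc u<n w<n uw) l≤k+1

  cycleDist-predecessor : ∀ {u w k} → u < n → w < n → cycleDist u w ≡ suc k →
                          ∃ λ v → v < n × Arc v 1 w × cycleDist u v ≡ k
  cycleDist-predecessor {u} {w} {k} u<n w<n d≡k+1 =
    predecessor (subst (λ l → Arc u l w) d≡k+1 (cycleDist-arc u<n w<n))
    where
    k+1≤m : suc k ≤ m
    k+1≤m = subst (_≤ m) d≡k+1 (cycleDist≤m u<n w<n)
    k≤m : k ≤ m
    k≤m = ≤-trans (n≤1+n k) k+1≤m
    predecessor : Arc u (suc k) w → ∃ λ v → v < n × Arc v 1 w × cycleDist u v ≡ k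
    predecessor (inj₁ uw)
      with shift-split k 1 u<n w<n (≤m⇒<n k≤m) (subst (λ l → Shift u l w) (+-comm 1 k) uw)
    ... | b , b<n , ub , bw = b , b<n , inj₁ bw , shift⇒cycleDist≡ u<n b<n k≤m ub
    predecessor (inj₂ wu) with shift-split 1 k w<n u<n (≤m⇒<n (≤-trans (s≤s z≤n) k+1≤m)) wu
    ... | b , b<n , wb , bu = b , b<n , inj₂ wb , reverseShift⇒cycleDist≡ u<n b<n k≤m bu

  Midpoint : ℕ → ℕ → ℕ → ℕ → Set
  Midpoint a b z d = Shift a d z × Shift z d b

  midpoint⇒shift : ∀ {a b z d} → a < n → d ≤ m → Midpoint a b z d → Shift a (d + d) b
  midpoint⇒shift a<n d≤m (az , zb) = shift-compose a<n (double<n d≤m) az zb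

  midpoint⇒equidistant : ∀ {a b z d} → a < n → b < n → z < n → d ≤ m → Midpoint a b z d →
                         cycleDist a z ≡ cycleDist b z
  midpoint⇒equidistant a<n b<n z<n d≤m (az , zb) =
    trans (shift⇒cycleDist≡ a<n z<n d≤m az) (sym (reverseShift⇒cycleDist≡ b<n z<n d≤m zb))

  even-clockwise⇒equidistant : ∀ {a b h} → a < n → b < n → clockwise a b ≡ h + h →
                               ∃ λ z → z < n × cycleDist a z ≡ cycleDist b z
  even-clockwise⇒equidistant {a} {b} {h} a<n b<n s≡h+h = equidistant (half≤m h+h<n)
    where
    h+h<n : h + h < n
    h+h<n = subst (_< n) s≡h+h (clockwise<n a b<n)
    equidistant : h ≤ m → ∃ λ z → z < n × cycleDist a z ≡ cycleDist b z
    equidistant h≤m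
      with shift-split h h a<n b<n (≤m⇒<n h≤m) (subst (λ k → Shift a k b) s≡h+h (clockwise-shift a<n))
    ... | z , z<n , mid = z , z<n , midpoint⇒equidistant a<n b<n z<n h≤m mid

  equidistant-exists : ∀ {i j} → i < n → j < n → ∃ λ z → z < n × cycleDist i z ≡ cycleDist j z
  equidistant-exists {i} {j} i<n j<n with evenOrOdd (clockwise i j) | evenOrOdd (clockwise j i)
  ... | h , inj₁ s≡h+h | _ = even-clockwise⇒equidistant {h = h} i<n j<n s≡h+h
  ... | _ | g , inj₁ t≡g+g with even-clockwise⇒equidistant {h = g} j<n i<n t≡g+g
  ...   | z , z<n , equidistant = z , z<n , sym equidistant
  equidistant-exists {i} {j} i<n j<n | h , inj₂ s≡2h+1 | g , inj₂ t≡2g+1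
    with shift-round-trip i<n (clockwise<n i j<n) (clockwise<n j i<n) (clockwise-shift i<n) (clockwise-shift j<n)
  ... | inj₁ s+t≡0 = contradiction (trans (sym (cong₂ _+_ s≡2h+1 t≡2g+1)) s+t≡0) λ ()
  ... | inj₂ s+t≡n = contradiction (begin
    suc (h + g) + suc (h + g)   ≡⟨ odd+odd h g ⟩
    suc (h + h) + suc (g + g)   ≡⟨ sym (cong₂ _+_ s≡2h+1 t≡2g+1) ⟩
    clockwise i j + clockwise j i ≡⟨ s+t≡n ⟩
    n                           ∎) (double≢n (suc (h + g)))
    where
    open ≡-Reasoning
    odd+odd : ∀ h g → suc (h + g) + suc (h + g) ≡ suc (h + h) + suc (g + g)
    odd+odd = solve-∀

  equidistant⇒midpoint : ∀ {i j z} → i < n → j < n → z < n → i ≢ j →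
                         cycleDist i z ≡ cycleDist j z →
                         Midpoint i j z (cycleDist i z) ⊎ Midpoint j i z (cycleDist i z)
  equidistant⇒midpoint {i} {j} {z} i<n j<n z<n i≢j e
    with cycleDist-arc i<n z<n | subst (λ d → Arc j d z) (sym e) (cycleDist-arc j<n z<n)
  ... | inj₁ iz | inj₁ jz = contradiction (shift-unique-source i<n j<n iz jz) i≢j
  ... | inj₁ iz | inj₂ zj = inj₁ (iz , zj)
  ... | inj₂ zi | inj₁ jz = inj₂ (jz , zi)
  ... | inj₂ zi | inj₂ zj = contradiction (shift-unique-target i<n j<n zi zj) i≢j

  midpoint-unique : ∀ {a b z z′ d d′} → a < n → z < n → z′ < n → d ≤ m → d′ ≤ m →
                    Midpoint a b z d → Midpoint a b z′ d′ → z ≡ z′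
  midpoint-unique {d = d} {d′} a<n z<n z′<n d≤m d′≤m mid mid′
    with double-injective {d} {d′} (shift-unique-length (double<n d≤m) (double<n d′≤m)
                                      (midpoint⇒shift a<n d≤m mid) (midpoint⇒shift a<n d′≤m mid′))
  ... | refl = shift-unique-target z<n z′<n (proj₁ mid) (proj₁ mid′)

  opposite-midpoints⇒≡ : ∀ {a b z z′ d d′} → a < n → b < n → d ≤ m → d′ ≤ m →
                         Midpoint a b z d → Midpoint b a z′ d′ → a ≡ b
  opposite-midpoints⇒≡ {a} {b} {d = d} {d′} a<n b<n d≤m d′≤m mid mid′ =
    roundTrip (shift-round-trip a<n (double<n d≤m) (double<n d′≤m) ab (midpoint⇒shift b<n d′≤m mid′))
    where
    ab : Shift a (d + d) b
    ab = midpoint⇒shift a<n d≤m mid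
    roundTrip : (d + d) + (d′ + d′) ≡ 0 ⊎ (d + d) + (d′ + d′) ≡ n → a ≡ b
    roundTrip (inj₁ sum≡0) = shift-zero a<n (subst (λ k → Shift a k b) (m+n≡0⇒m≡0 (d + d) sum≡0) ab)
    roundTrip (inj₂ sum≡n) = contradiction (trans (interchange d d′ d d′) sum≡n) (double≢n (d + d′))

  equidistant-unique : ∀ {i j z z′} → i < n → j < n → z < n → z′ < n → i ≢ j →
                       cycleDist i z ≡ cycleDist j z → cycleDist i z′ ≡ cycleDist j z′ → z ≡ z′
  equidistant-unique i<n j<n z<n z′<n i≢j e e′
    with cycleDist≤m i<n z<n | cycleDist≤m i<n z′<n
       | equidistant⇒midpoint i<n j<n z<n i≢j e | equidistant⇒midpoint i<n j<n z′<n i≢j e′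
  ... | d≤m | d′≤m | inj₁ mid | inj₁ mid′ = midpoint-unique i<n z<n z′<n d≤m d′≤m mid mid′
  ... | d≤m | d′≤m | inj₂ mid | inj₂ mid′ = midpoint-unique j<n z<n z′<n d≤m d′≤m mid mid′
  ... | d≤m | d′≤m | inj₁ mid | inj₂ mid′ =
    contradiction (opposite-midpoints⇒≡ i<n j<n d≤m d′≤m mid mid′) i≢j
  ... | d≤m | d′≤m | inj₂ mid | inj₁ mid′ =
    contradiction (opposite-midpoints⇒≡ i<n j<n d′≤m d≤m mid′ mid) i≢j

  cycleDist-via-successor : ∀ {j p z t} → j < n → p < n → z < n → suc t ≤ m →
                            Shift j 1 p → Shift j (suc t) z → cycleDist j z ≡ suc (cycleDist p z)
  cycleDist-via-successor {t = t} j<n p<n z<n t+1≤m jp jz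
    with shift-split 1 t j<n z<n (≤m⇒<n (≤-trans (s≤s z≤n) t+1≤m)) jz
  ... | b , b<n , jb , bz with shift-unique-target b<n p<n jb jp
  ... | refl = trans (shift⇒cycleDist≡ j<n z<n t+1≤m jz)
                     (cong suc (sym (shift⇒cycleDist≡ b<n z<n (≤-trans (n≤1+n t) t+1≤m) bz)))

  cycleDist-via-predecessor : ∀ {j p z t} → j < n → p < n → z < n → suc t ≤ m →
                              Shift j 1 p → Shift z (suc t) p → cycleDist p z ≡ suc (cycleDist j z)
  cycleDist-via-predecessor {p = p} {z} {t} j<n p<n z<n t+1≤m jp zp
    with shift-split t 1 z<n p<n (≤m⇒<n (≤-trans (n≤1+n t) t+1≤m))
                     (subst (λ k → Shift z k p) (+-comm 1 t) zp)
  ... | b , b<n , zb , bp with shift-unique-source b<n j<n bp jp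
  ... | refl = trans (reverseShift⇒cycleDist≡ p<n z<n t+1≤m zp)
                     (cong suc (sym (reverseShift⇒cycleDist≡ b<n z<n (≤-trans (n≤1+n t) t+1≤m) zb)))

module PrismDistance (m : ℕ) where

  open import Data.Nat hiding (eq?)
  open import Data.Nat.Properties hiding (eq?)
  open import Data.Bool using (Bool; T; _∨_; _∧_)
  open import Data.Bool.Properties using (T-∨; T-∧)
  open import Data.Fin using (Fin; zero; suc; toℕ; fromℕ<)
  open import Data.Fin.Properties using (toℕ<n; toℕ-fromℕ<; toℕ-injective) renaming (_≟_ to _≟F_)
  open import Data.List using (List; []; _∷_; length; map; allFin; cartesianProduct)
  open import Data.List.Properties using (length-++; length-map; length-tabulate)
  open import Data.List.Membership.Propositional using (_∈_; lose)
  open import Data.List.Relation.Unary.Any using (Any)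
  open import Data.List.Membership.Propositional.Properties using (∈-cartesianProduct⁺; ∈-allFin)
  open import Data.Product using (_×_; _,_)
  open import Data.Sum as Sum using (_⊎_; inj₁; inj₂)
  open import Function using (Equivalence)
  open import Relation.Nullary using (yes; no)
  open import Relation.Nullary.Decidable using (⌊_⌋; toWitness; fromWitness; toWitnessFalse; fromWitnessFalse)
  open import Relation.Nullary.Negation using (contradiction)
  open import Relation.Binary.PropositionalEquality
    using (_≡_; _≢_; refl; sym; trans; cong; cong₂; subst; module ≡-Reasoning)

  open Equivalence using (to; from)

  open OddCycle m public

  Prism : FinGraph
  Prism = K₂ □ C n

  V : Set
  V = Fin 2 × Fin n

  one : Fin 2
  one = suc zero

  layerDist : Fin 2 → Fin 2 → ℕ
  layerDist zero zero = 0
  layerDist zero (suc zero) = 1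
  layerDist (suc zero) zero = 1
  layerDist (suc zero) (suc zero) = 0

  layerDist-refl : ∀ a → layerDist a a ≡ 0
  layerDist-refl zero = refl
  layerDist-refl (suc zero) = refl

  layerDist≤1 : ∀ a b → layerDist a b ≤ 1
  layerDist≤1 zero zero = z≤n
  layerDist≤1 zero (suc zero) = ≤-refl
  layerDist≤1 (suc zero) zero = ≤-refl
  layerDist≤1 (suc zero) (suc zero) = z≤n

  layerDist≡0⇒≡ : ∀ {a b} → layerDist a b ≡ 0 → a ≡ b
  layerDist≡0⇒≡ {zero} {zero} _ = refl
  layerDist≡0⇒≡ {suc zero} {suc zero} _ = refl
  layerDist≡0⇒≡ {zero} {suc zero} ()
  layerDist≡0⇒≡ {suc zero} {zero} ()

  ≢⇒layerDist≡1 : ∀ {a b} → a ≢ b → layerDist a b ≡ 1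
  ≢⇒layerDist≡1 {zero} {zero} a≢b = contradiction refl a≢b
  ≢⇒layerDist≡1 {zero} {suc zero} _ = refl
  ≢⇒layerDist≡1 {suc zero} {zero} _ = refl
  ≢⇒layerDist≡1 {suc zero} {suc zero} a≢b = contradiction refl a≢b

  cycleDistF : Fin n → Fin n → ℕ
  cycleDistF i j = cycleDist (toℕ i) (toℕ j)

  prismDist : V → V → ℕ
  prismDist (a , i) (b , j) = layerDist a b + cycleDistF i j

  CycleAdjacent : ℕ → ℕ → Set
  CycleAdjacent a b = b ≡ suc a ⊎ a ≡ suc b ⊎ (a ≡ 0 × suc b ≡ n) ⊎ (b ≡ 0 × suc a ≡ n)

  -- The adjacency test of C n in Defs: adj (C n) i j unfolds to cycleAdj (toℕ i) (toℕ j).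
  -- Since T is not injective, the Boolean arguments of T-∨ and T-∧ are supplied explicitly below.
  cycleAdj : ℕ → ℕ → Bool
  cycleAdj a b = ⌊ b ≟ suc a ⌋ ∨ ⌊ a ≟ suc b ⌋
               ∨ (⌊ a ≟ 0 ⌋ ∧ ⌊ suc b ≟ n ⌋) ∨ (⌊ b ≟ 0 ⌋ ∧ ⌊ suc a ≟ n ⌋)

  cycleAdj⇒cycleAdjacent : ∀ a b → T (cycleAdj a b) → CycleAdjacent a b
  cycleAdj⇒cycleAdjacent a b t with to (T-∨ {⌊ b ≟ suc a ⌋}) t
  ... | inj₁ p = inj₁ (toWitness p)
  ... | inj₂ t with to (T-∨ {⌊ a ≟ suc b ⌋}) t
  ... | inj₁ p = inj₂ (inj₁ (toWitness p))
  ... | inj₂ t with to (T-∨ {⌊ a ≟ 0 ⌋ ∧ ⌊ suc b ≟ n ⌋}) t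
  ... | inj₁ pq with to (T-∧ {⌊ a ≟ 0 ⌋}) pq
  ...   | p , q = inj₂ (inj₂ (inj₁ (toWitness p , toWitness q)))
  cycleAdj⇒cycleAdjacent a b t | inj₂ _ | inj₂ _ | inj₂ pq with to (T-∧ {⌊ b ≟ 0 ⌋}) pq
  ...   | p , q = inj₂ (inj₂ (inj₂ (toWitness p , toWitness q)))

  cycleAdjacent⇒cycleAdj : ∀ {a b} → CycleAdjacent a b → T (cycleAdj a b)
  cycleAdjacent⇒cycleAdj {a} {b} adjacent = from (T-∨ {⌊ b ≟ suc a ⌋}) (Sum.map fromWitness
    (λ rest → from (T-∨ {⌊ a ≟ suc b ⌋}) (Sum.map fromWitness
       (λ wrap → from (T-∨ {⌊ a ≟ 0 ⌋ ∧ ⌊ suc b ≟ n ⌋}) (Sum.map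
          (λ (p , q) → from (T-∧ {⌊ a ≟ 0 ⌋}) (fromWitness p , fromWitness q))
          (λ (p , q) → from (T-∧ {⌊ b ≟ 0 ⌋}) (fromWitness p , fromWitness q)) wrap)) rest)) adjacent)

  cycleAdjacent⇒arc : ∀ {a b} → CycleAdjacent a b → Arc a 1 b
  cycleAdjacent⇒arc {a} (inj₁ refl) = inj₁ (direct (+-comm a 1))
  cycleAdjacent⇒arc {b = b} (inj₂ (inj₁ refl)) = inj₂ (direct (+-comm b 1))
  cycleAdjacent⇒arc {b = b} (inj₂ (inj₂ (inj₁ (refl , b+1≡n)))) =
    inj₂ (wrapped (trans (+-comm b 1) b+1≡n))
  cycleAdjacent⇒arc {a} (inj₂ (inj₂ (inj₂ (refl , a+1≡n)))) =
    inj₁ (wrapped (trans (+-comm a 1) a+1≡n))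

  arc⇒cycleAdjacent : ∀ {a b} → a < n → b < n → Arc a 1 b → CycleAdjacent a b
  arc⇒cycleAdjacent {a} _ _ (inj₁ (direct e)) = inj₁ (trans (sym e) (+-comm a 1))
  arc⇒cycleAdjacent {b = b} _ _ (inj₂ (direct e)) = inj₂ (inj₁ (trans (sym e) (+-comm b 1)))
  arc⇒cycleAdjacent {a} {b} _ b<n (inj₂ (wrapped e)) =
    inj₂ (inj₂ (inj₁ (a≡0 , trans (+-comm 1 b) (trans e (cong (_+ n) a≡0)))))
    where
    a≡0 : a ≡ 0
    a≡0 = wrapped-step⇒≡0 b<n e
  arc⇒cycleAdjacent {a} {b} a<n _ (inj₁ (wrapped e)) =
    inj₂ (inj₂ (inj₂ (b≡0 , trans (+-comm 1 a) (trans e (cong (_+ n) b≡0)))))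
    where
    b≡0 : b ≡ 0
    b≡0 = wrapped-step⇒≡0 a<n e

  prismAdj⇒ : ∀ c w b j → T (adj Prism (c , w) (b , j)) →
              (c ≡ b × Arc (toℕ w) 1 (toℕ j)) ⊎ (w ≡ j × c ≢ b)
  prismAdj⇒ c w b j t with to (T-∨ {⌊ c ≟F b ⌋ ∧ cycleAdj (toℕ w) (toℕ j)}) t
  ... | inj₁ sameLayer with to (T-∧ {⌊ c ≟F b ⌋}) sameLayer
  ...   | c≡b , wj = inj₁ (toWitness c≡b , cycleAdjacent⇒arc (cycleAdj⇒cycleAdjacent _ _ wj))
  prismAdj⇒ c w b j t | inj₂ rung with to (T-∧ {⌊ w ≟F j ⌋}) rung
  ...   | w≡j , c≢b = inj₂ (toWitness w≡j , toWitnessFalse c≢b)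

  arc⇒prismAdj : ∀ c w j → Arc (toℕ w) 1 (toℕ j) → T (adj Prism (c , w) (c , j))
  arc⇒prismAdj c w j wj = from (T-∨ {⌊ c ≟F c ⌋ ∧ cycleAdj (toℕ w) (toℕ j)}) (inj₁
    (from (T-∧ {⌊ c ≟F c ⌋}) (fromWitness refl , cycleAdjacent⇒cycleAdj (arc⇒cycleAdjacent w<n j<n wj))))
    where
    w<n : toℕ w < n
    w<n = toℕ<n w
    j<n : toℕ j < n
    j<n = toℕ<n j

  rung⇒prismAdj : ∀ c b j → c ≢ b → T (adj Prism (c , j) (b , j))
  rung⇒prismAdj c b j c≢b = from (T-∨ {⌊ c ≟F b ⌋ ∧ cycleAdj (toℕ j) (toℕ j)}) (inj₂
    (from (T-∧ {⌊ j ≟F j ⌋}) (fromWitness refl , fromWitnessFalse c≢b)))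

  prismDist-sameLayer : ∀ a i j → prismDist (a , i) (a , j) ≡ cycleDistF i j
  prismDist-sameLayer a i j = cong (_+ cycleDistF i j) (layerDist-refl a)

  prismDist-otherLayer : ∀ {a b} i j → a ≢ b → prismDist (a , i) (b , j) ≡ suc (cycleDistF i j)
  prismDist-otherLayer i j a≢b = cong (_+ cycleDistF i j) (≢⇒layerDist≡1 a≢b)

  ∈-vertices : ∀ x → x ∈ verts Prism
  ∈-vertices (a , w) = ∈-cartesianProduct⁺ (∈-allFin a) (∈-allFin w)

  length-allFin : length (allFin n) ≡ n
  length-allFin = length-tabulate (λ i → i)

  length-cartesianProduct : {A B : Set} (xs : List A) (ys : List B) →
                            length (cartesianProduct xs ys) ≡ length xs * length ys
  length-cartesianProduct [] ys = refl
  length-cartesianProduct (x ∷ xs) ys =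
    trans (length-++ (map (x ,_) ys)) (cong₂ _+_ (length-map (x ,_) ys) (length-cartesianProduct xs ys))

  length-vertices : length (verts Prism) ≡ 2 * n
  length-vertices = trans (length-cartesianProduct (allFin 2) (allFin n)) (cong (2 *_) length-allFin)

  eq⇒prismDist≡0 : ∀ x y → T (eq? Prism x y) → prismDist x y ≡ 0
  eq⇒prismDist≡0 (a , i) (b , j) t with to (T-∧ {⌊ a ≟F b ⌋}) t
  ... | a≡b , i≡j with toWitness a≡b | toWitness i≡j
  ... | refl | refl = trans (prismDist-sameLayer a i i) (cycleDist-refl (toℕ<n i))

  prismDist≡0⇒eq : ∀ x y → prismDist x y ≡ 0 → T (eq? Prism x y)
  prismDist≡0⇒eq (a , i) (b , j) d≡0 = from (T-∧ {⌊ a ≟F b ⌋}) (fromWitness a≡b , fromWitness (toℕ-injective i≡j))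
    where
    a≡b : a ≡ b
    a≡b = layerDist≡0⇒≡ (m+n≡0⇒m≡0 (layerDist a b) d≡0)
    i≡j : toℕ i ≡ toℕ j
    i≡j = cycleDist≡0⇒≡ (toℕ<n i) (toℕ<n j) (m+n≡0⇒n≡0 (layerDist a b) d≡0)

  prismDist-adj : ∀ x y z → T (adj Prism y z) → prismDist x z ≤ suc (prismDist x y)
  prismDist-adj (a , i) (c , w) (b , j) t with prismAdj⇒ c w b j t
  ... | inj₁ (refl , wj) =
    ≤-trans (+-monoʳ-≤ (layerDist a c) (cycleDist-adj (toℕ<n i) (toℕ<n w) (toℕ<n j) wj))
            (≤-reflexive (+-suc (layerDist a c) (cycleDistF i w)))
  ... | inj₂ (refl , _) = +-monoˡ-≤ (cycleDistF i w) (≤-trans (layerDist≤1 a b) (s≤s z≤n))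

  prismDist-predecessor : ∀ x z k → prismDist x z ≡ suc k →
                          Any (λ y → T (adj Prism y z) × prismDist x y ≡ k) (verts Prism)
  prismDist-predecessor (a , i) (b , j) k d≡k+1 with a ≟F b
  ... | yes refl with cycleDist-predecessor (toℕ<n i) (toℕ<n j) (trans (sym (prismDist-sameLayer a i j)) d≡k+1)
  ... | v , v<n , vj , d′≡k = lose (∈-vertices (a , fromℕ< v<n))
    ( arc⇒prismAdj a (fromℕ< v<n) j (subst (λ t → Arc t 1 (toℕ j)) (sym v≡) vj)
    , trans (prismDist-sameLayer a i (fromℕ< v<n)) (trans (cong (cycleDist (toℕ i)) v≡) d′≡k) )
    where
    v≡ : toℕ (fromℕ< v<n) ≡ v
    v≡ = toℕ-fromℕ< v<n
  prismDist-predecessor (a , i) (b , j) k d≡k+1 | no a≢b = lose (∈-vertices (a , j))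
    ( rung⇒prismAdj a b j a≢b
    , trans (prismDist-sameLayer a i j) (suc-injective (trans (sym (prismDist-otherLayer i j a≢b)) d≡k+1)))

  prismDist≤|V| : ∀ x y → prismDist x y ≤ length (verts Prism)
  prismDist≤|V| (a , i) (b , j) = begin
    layerDist a b + cycleDistF i j ≤⟨ +-mono-≤ (layerDist≤1 a b) (cycleDist≤m (toℕ<n i) (toℕ<n j)) ⟩
    suc m                          ≤⟨ s≤s (m≤m+n m m) ⟩
    n                              ≤⟨ m≤m+n n (n + 0) ⟩
    2 * n                          ≡⟨ sym length-vertices ⟩
    length (verts Prism)           ∎
    where open ≤-Reasoning

  open GraphDistance.DistanceCharacterisation
         Prism prismDist eq⇒prismDist≡0 prismDist≡0⇒eq prismDist-adj prismDist-predecessor prismDist≤|V|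
    public using () renaming (dist≡D to dist≡prismDist)

module Weights where

  open Counting using (count)
  open import Data.Nat as ℕ using (ℕ; zero; suc)
  import Data.Nat.Properties as ℕ
  open import Data.Integer as ℤ using (1ℤ)
  import Data.Integer.Properties as ℤ
  open import Data.Integer.Tactic.RingSolver using (solve-∀)
  open import Data.Rational using (ℚ; 0ℚ; 1ℚ; _+_; _*_; _≤_; _/_; toℚᵘ; nonNegative)
  open import Data.Rational.Properties
    using ( toℚᵘ-injective; toℚᵘ-fromℚᵘ; toℚᵘ-homo-+; toℚᵘ-homo-*; +-0-commutativeMonoid
          ; ≤-refl; +-identityˡ; +-identityʳ; +-mono-≤; +-monoʳ-≤; nonNegative⁻¹
          ; *-zeroˡ; *-zeroʳ; *-identityˡ; *-distribˡ-+; *-distribʳ-+; *-monoʳ-≤-nonNeg; module ≤-Reasoning )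
  open import Data.Rational.Unnormalised as ℚᵘ using (mkℚᵘ; *≡*)
  import Data.Rational.Unnormalised.Properties as ℚᵘ
  open import Algebra.Bundles using (CommutativeMonoid)
  open import Algebra.Properties.CommutativeSemigroup
    (CommutativeMonoid.commutativeSemigroup +-0-commutativeMonoid) using (interchange)
  open import Data.Bool using (true; false; if_then_else_)
  open import Data.List using (List; []; _∷_; length; filter)
  open import Level using (0ℓ)
  open import Relation.Nullary using (does)
  open import Relation.Unary using (Pred; Decidable)
  open import Relation.Binary.PropositionalEquality
    using (_≡_; refl; sym; trans; cong; cong₂; subst; subst₂; module ≡-Reasoning)

  fromℕ : ℕ → ℚ
  fromℕ k = (ℤ.+ k) / 1

  fromℕ-suc : ∀ k → fromℕ (suc k) ≡ 1ℚ + fromℕ k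
  fromℕ-suc k = toℚᵘ-injective (begin
    toℚᵘ (fromℕ (suc k))          ≈⟨ toℚᵘ-fromℚᵘ (mkℚᵘ (ℤ.+ suc k) 0) ⟩
    mkℚᵘ (ℤ.+ suc k) 0            ≈⟨ *≡* (1+x≡1·1+x·1 (ℤ.+ k)) ⟩
    mkℚᵘ 1ℤ 0 ℚᵘ.+ k/1            ≈⟨ ℚᵘ.+-congʳ (mkℚᵘ 1ℤ 0) (ℚᵘ.≃-sym (toℚᵘ-fromℚᵘ k/1)) ⟩
    toℚᵘ 1ℚ ℚᵘ.+ toℚᵘ (fromℕ k)   ≈⟨ ℚᵘ.≃-sym (toℚᵘ-homo-+ 1ℚ (fromℕ k)) ⟩
    toℚᵘ (1ℚ + fromℕ k)           ∎)
    where
    open ℚᵘ.≃-Reasoning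
    k/1 : ℚᵘ.ℚᵘ
    k/1 = mkℚᵘ (ℤ.+ k) 0
    1+x≡1·1+x·1 : ∀ x → (1ℤ ℤ.+ x) ℤ.* 1ℤ ≡ (1ℤ ℤ.* 1ℤ ℤ.+ x ℤ.* 1ℤ) ℤ.* 1ℤ
    1+x≡1·1+x·1 = solve-∀

  fromℕ-*-/ : ∀ k a b c d → k ℕ.* a ℕ.* suc d ≡ c ℕ.* suc b →
              fromℕ k * ((ℤ.+ a) / suc b) ≡ (ℤ.+ c) / suc d
  fromℕ-*-/ k a b c d e = toℚᵘ-injective (begin
    toℚᵘ (fromℕ k * ((ℤ.+ a) / suc b))
      ≈⟨ toℚᵘ-homo-* (fromℕ k) ((ℤ.+ a) / suc b) ⟩
    toℚᵘ (fromℕ k) ℚᵘ.* toℚᵘ ((ℤ.+ a) / suc b)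
      ≈⟨ ℚᵘ.*-cong (toℚᵘ-fromℚᵘ k/1) (toℚᵘ-fromℚᵘ a/b+1) ⟩
    k/1 ℚᵘ.* a/b+1
      ≈⟨ *≡* crossMultiplied ⟩
    mkℚᵘ (ℤ.+ c) d
      ≈⟨ ℚᵘ.≃-sym (toℚᵘ-fromℚᵘ (mkℚᵘ (ℤ.+ c) d)) ⟩
    toℚᵘ ((ℤ.+ c) / suc d)
      ∎)
    where
    open ℚᵘ.≃-Reasoning
    k/1 : ℚᵘ.ℚᵘ
    k/1 = mkℚᵘ (ℤ.+ k) 0
    a/b+1 : ℚᵘ.ℚᵘ
    a/b+1 = mkℚᵘ (ℤ.+ a) b
    crossMultiplied : (ℤ.+ k ℤ.* ℤ.+ a) ℤ.* ℤ.+ suc d ≡ ℤ.+ c ℤ.* ℤ.+ suc (b ℕ.+ 0)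
    crossMultiplied =
      trans (cong (ℤ._* ℤ.+ suc d) (sym (ℤ.pos-* k a))) (trans (sym (ℤ.pos-* (k ℕ.* a) (suc d)))
        (trans (cong ℤ.+_ e) (trans (ℤ.pos-* c (suc b))
          (cong (λ t → ℤ.+ c ℤ.* ℤ.+ suc t) (sym (ℕ.+-identityʳ b))))))

  fromℕ-mono-≤ : ∀ {a b} → a ℕ.≤ b → fromℕ a ≤ fromℕ b
  fromℕ-mono-≤ {zero} {zero} _ = ≤-refl
  fromℕ-mono-≤ {zero} {suc b} _ =
    subst₂ _≤_ (+-identityʳ 0ℚ) (sym (fromℕ-suc b))
               (+-mono-≤ (nonNegative⁻¹ 1ℚ) (fromℕ-mono-≤ {zero} {b} ℕ.z≤n))
  fromℕ-mono-≤ {suc a} {suc b} (ℕ.s≤s a≤b) =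
    subst₂ _≤_ (sym (fromℕ-suc a)) (sym (fromℕ-suc b)) (+-monoʳ-≤ 1ℚ (fromℕ-mono-≤ a≤b))

  module _ {A : Set} where

    sumℚ-const : ∀ c (xs : List A) → sumℚ (λ _ → c) xs ≡ fromℕ (length xs) * c
    sumℚ-const c [] = sym (*-zeroˡ c)
    sumℚ-const c (x ∷ xs) = begin
      c + sumℚ (λ _ → c) xs          ≡⟨ cong₂ _+_ (sym (*-identityˡ c)) (sumℚ-const c xs) ⟩
      1ℚ * c + fromℕ (length xs) * c ≡⟨ sym (*-distribʳ-+ c 1ℚ (fromℕ (length xs))) ⟩
      (1ℚ + fromℕ (length xs)) * c   ≡⟨ cong (_* c) (sym (fromℕ-suc (length xs))) ⟩
      fromℕ (suc (length xs)) * c    ∎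
      where open ≡-Reasoning

    sumℚ-cong : ∀ {f g : A → ℚ} → (∀ x → f x ≡ g x) → ∀ xs → sumℚ f xs ≡ sumℚ g xs
    sumℚ-cong f≡g [] = refl
    sumℚ-cong f≡g (x ∷ xs) = cong₂ _+_ (f≡g x) (sumℚ-cong f≡g xs)

    sumℚ-mono-≤ : ∀ {f g : A → ℚ} → (∀ x → f x ≤ g x) → ∀ xs → sumℚ f xs ≤ sumℚ g xs
    sumℚ-mono-≤ f≤g [] = ≤-refl
    sumℚ-mono-≤ f≤g (x ∷ xs) = +-mono-≤ (f≤g x) (sumℚ-mono-≤ f≤g xs)

    sumℚ-+ : ∀ (f g : A → ℚ) xs → sumℚ f xs + sumℚ g xs ≡ sumℚ (λ x → f x + g x) xs
    sumℚ-+ f g [] = +-identityˡ 0ℚ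
    sumℚ-+ f g (x ∷ xs) =
      trans (interchange (f x) (sumℚ f xs) (g x) (sumℚ g xs)) (cong ((f x + g x) +_) (sumℚ-+ f g xs))

    sumℚ-*ˡ : ∀ c (f : A → ℚ) xs → sumℚ (λ x → c * f x) xs ≡ c * sumℚ f xs
    sumℚ-*ˡ c f [] = sym (*-zeroʳ c)
    sumℚ-*ˡ c f (x ∷ xs) =
      trans (cong (c * f x +_) (sumℚ-*ˡ c f xs)) (sym (*-distribˡ-+ c (f x) (sumℚ f xs)))

    sumℚ-filter : ∀ (f : A → ℚ) {P : Pred A 0ℓ} (P? : Decidable P) xs →
                  sumℚ f (filter P? xs) ≡ sumℚ (λ x → if does (P? x) then f x else 0ℚ) xs
    sumℚ-filter f P? [] = refl
    sumℚ-filter f P? (x ∷ xs) with does (P? x)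
    ... | true = cong (f x +_) (sumℚ-filter f P? xs)
    ... | false = trans (sumℚ-filter f P? xs) (sym (+-identityˡ _))

    fromℕ-length≤sumℚ : ∀ {f : A → ℚ} → (∀ x → 1ℚ ≤ f x) → ∀ xs →
                        fromℕ (length xs) ≤ sumℚ f xs
    fromℕ-length≤sumℚ 1≤f [] = ≤-refl
    fromℕ-length≤sumℚ {f} 1≤f (x ∷ xs) =
      subst (_≤ sumℚ f (x ∷ xs)) (sym (fromℕ-suc (length xs)))
            (+-mono-≤ (1≤f x) (fromℕ-length≤sumℚ 1≤f xs))

  sumℚ-swap : ∀ {A B : Set} (g : A → B → ℚ) xs ys →
              sumℚ (λ x → sumℚ (g x) ys) xs ≡ sumℚ (λ y → sumℚ (λ x → g x y) xs) ys
  sumℚ-swap g [] ys = sym (trans (sumℚ-const 0ℚ ys) (*-zeroʳ (fromℕ (length ys))))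
  sumℚ-swap g (x ∷ xs) ys = trans (cong (sumℚ (g x) ys +_) (sumℚ-swap g xs ys)) (sumℚ-+ (g x) _ ys)

  double-counting : ∀ {A B : Set} {R : B → A → Set} (R? : ∀ j → Decidable (R j)) {f : A → ℚ} k js vs →
                    (∀ v → 0ℚ ≤ f v) → (∀ v → count (λ j → R? j v) js ℕ.≤ k) →
                    sumℚ (λ j → sumℚ f (filter (R? j) vs)) js ≤ fromℕ k * sumℚ f vs
  double-counting R? {f} k js vs 0≤f covered = begin
    sumℚ (λ j → sumℚ f (filter (R? j) vs)) js      ≡⟨ sumℚ-cong (λ j → sumℚ-filter f (R? j) vs) js ⟩
    sumℚ (λ j → sumℚ (λ v → [R] j v) vs) js        ≡⟨ sumℚ-swap [R] js vs ⟩
    sumℚ (λ v → sumℚ (λ j → [R] j v) js) vs        ≡⟨ sumℚ-cong multiplicity vs ⟩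
    sumℚ (λ v → fromℕ (count (λ j → R? j v) js) * f v) vs ≤⟨ sumℚ-mono-≤ bounded vs ⟩
    sumℚ (λ v → fromℕ k * f v) vs                  ≡⟨ sumℚ-*ˡ (fromℕ k) f vs ⟩
    fromℕ k * sumℚ f vs                            ∎
    where
    open ≤-Reasoning
    [R] : _ → _ → ℚ
    [R] j v = if does (R? j v) then f v else 0ℚ
    multiplicity : ∀ v → sumℚ (λ j → [R] j v) js ≡ fromℕ (count (λ j → R? j v) js) * f v
    multiplicity v = trans (sym (sumℚ-filter (λ _ → f v) (λ j → R? j v) js))
                           (sumℚ-const (f v) (filter (λ j → R? j v) js))
    bounded : ∀ v → fromℕ (count (λ j → R? j v) js) * f v ≤ fromℕ k * f v
    bounded v = *-monoʳ-≤-nonNeg (f v) {{nonNegative (0≤f v)}} (fromℕ-mono-≤ (covered v))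

module Resolving (m : ℕ) (1≤m : 1 Data.Nat.≤ m) where

  open Counting
  open import Data.Nat hiding (eq?)
  open import Data.Nat.Properties hiding (eq?)
  open import Data.Fin using (Fin; zero; suc; toℕ; fromℕ<)
  open import Data.Fin.Properties using (toℕ<n; toℕ-fromℕ<; toℕ-injective) renaming (_≟_ to _≟F_)
  open import Data.List using ([]; length; map; allFin)
  open import Data.List.Membership.Propositional using (lose)
  open import Data.List.Membership.Propositional.Properties using (∈-allFin)
  open import Data.List.Relation.Unary.All as All using (All)
  open import Data.List.Relation.Unary.Any using (Any)
  open import Data.List.Relation.Unary.Unique.Propositional.Properties using (allFin⁺)
  open import Data.Product using (∃; _×_; _,_; proj₁; proj₂)
  open import Data.Sum using (_⊎_; inj₁; inj₂)
  open import Relation.Nullary using (yes; no; ¬_)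
  open import Relation.Nullary.Decidable using (¬?; decidable-stable)
  open import Relation.Nullary.Negation using (contradiction)
  open import Relation.Unary using (Pred; Decidable)
  open import Relation.Binary.PropositionalEquality
    using (_≡_; _≢_; refl; sym; trans; cong; cong₂; subst; module ≡-Reasoning)
  open import Level using (0ℓ)

  open PrismDistance m public

  Resolves : V → V → V → Set
  Resolves x y z = ¬ (dist Prism x z ≡ dist Prism y z)

  resolves? : ∀ x y → Decidable (Resolves x y)
  resolves? x y z = ¬? (dist Prism x z ≟ dist Prism y z)

  prismDist≢⇒resolves : ∀ x y z → prismDist x z ≢ prismDist y z → Resolves x y z
  prismDist≢⇒resolves x y z d≢ e = d≢ (trans (sym (dist≡prismDist x z)) (trans e (dist≡prismDist y z)))

  prismDist≡⇒¬resolves : ∀ x y z → prismDist x z ≡ prismDist y z → ¬ Resolves x y z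
  prismDist≡⇒¬resolves x y z d≡ r = r (trans (dist≡prismDist x z) (trans d≡ (sym (dist≡prismDist y z))))

  ¬resolves⇒prismDist≡ : ∀ x y z → ¬ Resolves x y z → prismDist x z ≡ prismDist y z
  ¬resolves⇒prismDist≡ x y z ¬r = trans (sym (dist≡prismDist x z))
    (trans (decidable-stable (dist Prism x z ≟ dist Prism y z) ¬r) (dist≡prismDist y z))

  count-layers : ∀ {P : Pred V 0ℓ} (P? : Decidable P) →
                 count P? (verts Prism) ≡ count (λ w → P? (zero , w)) (allFin n) + count (λ w → P? (one , w)) (allFin n)
  count-layers P? = trans (count-++ P? (map (zero ,_) (allFin n)) _)
    (cong₂ _+_ (count-map P? (zero ,_) (allFin n))
      (trans (count-++ P? (map (one ,_) (allFin n)) []) (trans (+-identityʳ _) (count-map P? (one ,_) (allFin n)))))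

  count-distinctLayers : ∀ {P : Pred V 0ℓ} (P? : Decidable P) {a b} → a ≢ b →
                         count P? (verts Prism) ≡ count (λ w → P? (a , w)) (allFin n) + count (λ w → P? (b , w)) (allFin n)
  count-distinctLayers P? {zero} {zero} a≢b = contradiction refl a≢b
  count-distinctLayers P? {suc zero} {suc zero} a≢b = contradiction refl a≢b
  count-distinctLayers P? {zero} {suc zero} _ = count-layers P?
  count-distinctLayers P? {suc zero} {zero} _ =
    trans (count-layers P?) (+-comm (count (λ w → P? (zero , w)) (allFin n)) _)

  equidistantF-exists : ∀ i j → ∃ λ z → cycleDistF i z ≡ cycleDistF j z
  equidistantF-exists i j with equidistant-exists (toℕ<n i) (toℕ<n j)
  ... | z , z<n , e = fromℕ< z<n , subst (λ t → cycleDist (toℕ i) t ≡ cycleDist (toℕ j) t) (sym (toℕ-fromℕ< z<n)) e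

  module _ {a b : Fin 2} (i j : Fin n) (a≢b : a ≢ b) where

    closer-resolvesˡ : ∀ {w} → cycleDistF i w ≤ cycleDistF j w → Resolves (a , i) (b , j) (a , w)
    closer-resolvesˡ {w} i≤j = prismDist≢⇒resolves (a , i) (b , j) (a , w) λ e → <⇒≢ (s≤s i≤j)
      (trans (sym (prismDist-sameLayer a i w)) (trans e (prismDist-otherLayer j w (λ b≡a → a≢b (sym b≡a)))))

    closer-resolvesʳ : ∀ {w} → cycleDistF j w ≤ cycleDistF i w → Resolves (a , i) (b , j) (b , w)
    closer-resolvesʳ {w} j≤i = prismDist≢⇒resolves (a , i) (b , j) (b , w) λ e → <⇒≢ (s≤s j≤i)
      (trans (sym (prismDist-sameLayer b j w)) (trans (sym e) (prismDist-otherLayer i w a≢b)))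

    #resolvers>n-distinctLayers : suc n ≤ count (resolves? (a , i) (b , j)) (verts Prism)
    #resolvers>n-distinctLayers = begin
      suc n                                         ≡⟨ cong suc (sym length-allFin) ⟩
      suc (length (allFin n))                       ≤⟨ count-cover-overlap inA? inB? everyColumn equidistant ⟩
      count inA? (allFin n) + count inB? (allFin n) ≡⟨ sym (count-distinctLayers (resolves? (a , i) (b , j)) a≢b) ⟩
      count (resolves? (a , i) (b , j)) (verts Prism) ∎
      where
      open ≤-Reasoning
      inA? : Decidable (λ w → Resolves (a , i) (b , j) (a , w))
      inA? w = resolves? (a , i) (b , j) (a , w)
      inB? : Decidable (λ w → Resolves (a , i) (b , j) (b , w))
      inB? w = resolves? (a , i) (b , j) (b , w)
      closer : ∀ w → Resolves (a , i) (b , j) (a , w) ⊎ Resolves (a , i) (b , j) (b , w)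
      closer w with ≤-total (cycleDistF i w) (cycleDistF j w)
      ... | inj₁ i≤j = inj₁ (closer-resolvesˡ i≤j)
      ... | inj₂ j≤i = inj₂ (closer-resolvesʳ j≤i)
      everyColumn : All (λ w → Resolves (a , i) (b , j) (a , w) ⊎ Resolves (a , i) (b , j) (b , w)) (allFin n)
      everyColumn = All.universal closer (allFin n)
      equidistant : Any (λ w → Resolves (a , i) (b , j) (a , w) × Resolves (a , i) (b , j) (b , w)) (allFin n)
      equidistant with equidistantF-exists i j
      ... | z , e = lose (∈-allFin z) (closer-resolvesˡ (≤-reflexive e) , closer-resolvesʳ (≤-reflexive (sym e)))

  module _ (a : Fin 2) {i j : Fin n} (i≢j : i ≢ j) where

    #resolversInLayer≥2m : ∀ c → m + m ≤ count (λ w → resolves? (a , i) (a , j) (c , w)) (allFin n)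
    #resolversInLayer≥2m c = ≤-pred (subst (_≤ suc (count inC? (allFin n))) length-allFin
                                            (length≤1+count inC? (allFin⁺ n) atMostOne))
      where
      inC? : Decidable (λ w → Resolves (a , i) (a , j) (c , w))
      inC? w = resolves? (a , i) (a , j) (c , w)
      equidistant : ∀ {z} → ¬ Resolves (a , i) (a , j) (c , z) → cycleDistF i z ≡ cycleDistF j z
      equidistant {z} ¬r = +-cancelˡ-≡ (layerDist a c) _ _ (¬resolves⇒prismDist≡ (a , i) (a , j) (c , z) ¬r)
      atMostOne : ∀ {z z′} → ¬ Resolves (a , i) (a , j) (c , z) → ¬ Resolves (a , i) (a , j) (c , z′) → z ≡ z′
      atMostOne {z} {z′} ¬r ¬r′ = toℕ-injective (equidistant-unique (toℕ<n i) (toℕ<n j) (toℕ<n z) (toℕ<n z′)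
        (λ e → i≢j (toℕ-injective e)) (equidistant ¬r) (equidistant ¬r′))

    #resolvers>n-sameLayer : suc n ≤ count (resolves? (a , i) (a , j)) (verts Prism)
    #resolvers>n-sameLayer = begin
      suc n                 ≤⟨ +-monoˡ-≤ (m + m) (+-mono-≤ 1≤m 1≤m) ⟩
      (m + m) + (m + m)     ≤⟨ +-mono-≤ (#resolversInLayer≥2m zero) (#resolversInLayer≥2m one) ⟩
      count (λ w → resolves? (a , i) (a , j) (zero , w)) (allFin n)
        + count (λ w → resolves? (a , i) (a , j) (one , w)) (allFin n)
                            ≡⟨ sym (count-layers (resolves? (a , i) (a , j))) ⟩
      count (resolves? (a , i) (a , j)) (verts Prism) ∎
      where open ≤-Reasoning

  #resolvers>n : ∀ x y → x ≢ y → suc n ≤ count (resolves? x y) (verts Prism)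
  #resolvers>n (a , i) (b , j) x≢y with a ≟F b
  ... | yes refl = #resolvers>n-sameLayer a (λ i≡j → x≢y (cong (a ,_) i≡j))
  ... | no a≢b = #resolvers>n-distinctLayers i j a≢b

  1<n : 1 < n
  1<n = ≤m⇒<n 1≤m

  next : Fin n → Fin n
  next j = fromℕ< (proj₁ (proj₂ (shift-exists (toℕ<n j) 1<n)))

  next-shift : ∀ j → Shift (toℕ j) 1 (toℕ (next j))
  next-shift j with shift-exists (toℕ<n j) 1<n
  ... | _ , b<n , jb = subst (Shift (toℕ j) 1) (sym (toℕ-fromℕ< b<n)) jb

  twistedPairResolvedBy? : ∀ v → Decidable (λ j → Resolves (zero , j) (one , next j) v)
  twistedPairResolvedBy? v j = resolves? (zero , j) (one , next j) v

  -- (0 , z) fails to resolve (0 , j) and (1 , j + 1) unless z is within m clockwise steps of j, since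
  -- otherwise the short way from j to z leaves through j + 1; dually for (1 , z). Either way at most
  -- m + 1 indices j remain, told apart by the clockwise distance.
  #resolvedTwistedPairs≤m+1 : ∀ v → count (twistedPairResolvedBy? v) (allFin n) ≤ suc m
  #resolvedTwistedPairs≤m+1 (zero , z) = count-≤-injection (twistedPairResolvedBy? (zero , z)) (allFin⁺ n) φ (suc m)
    (λ {j} {j′} _ _ e → toℕ-injective (clockwise-injectiveʳ (toℕ<n z) (toℕ<n j) (toℕ<n j′) e)) bound
    where
    φ : Fin n → ℕ
    φ j = clockwise (toℕ z) (toℕ j)
    bound : ∀ {j} → Resolves (zero , j) (one , next j) (zero , z) → φ j < suc m
    bound {j} r with φ j ≤? m
    ... | yes φj≤m = s≤s φj≤m
    ... | no φj≰m with clockwise-far (toℕ<n z) (toℕ<n j) (≰⇒> φj≰m)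
    ... | t , t+1≤m , jz = contradiction r (prismDist≡⇒¬resolves (zero , j) (one , next j) (zero , z) (begin
      prismDist (zero , j) (zero , z)     ≡⟨ prismDist-sameLayer zero j z ⟩
      cycleDistF j z                      ≡⟨ viaNext ⟩
      suc (cycleDistF (next j) z)         ≡⟨ sym (prismDist-otherLayer {one} {zero} (next j) z (λ ())) ⟩
      prismDist (one , next j) (zero , z) ∎))
      where
      open ≡-Reasoning
      viaNext : cycleDistF j z ≡ suc (cycleDistF (next j) z)
      viaNext = cycleDist-via-successor (toℕ<n j) (toℕ<n (next j)) (toℕ<n z) t+1≤m (next-shift j) jz
  #resolvedTwistedPairs≤m+1 (suc zero , z) =
    count-≤-injection (twistedPairResolvedBy? (one , z)) (allFin⁺ n) φ (suc m) injective bound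
    where
    φ : Fin n → ℕ
    φ j = clockwise (toℕ (next j)) (toℕ z)
    injective : ∀ {j j′} → _ → _ → φ j ≡ φ j′ → j ≡ j′
    injective {j} {j′} _ _ e = toℕ-injective (shift-unique-source (toℕ<n j) (toℕ<n j′) (next-shift j)
      (subst (Shift (toℕ j′) 1) (sym (clockwise-injectiveˡ (toℕ<n (next j)) (toℕ<n (next j′)) e)) (next-shift j′)))
    bound : ∀ {j} → Resolves (zero , j) (one , next j) (one , z) → φ j < suc m
    bound {j} r with φ j ≤? m
    ... | yes φj≤m = s≤s φj≤m
    ... | no φj≰m with clockwise-far (toℕ<n (next j)) (toℕ<n z) (≰⇒> φj≰m)
    ... | t , t+1≤m , zp = contradiction r (prismDist≡⇒¬resolves (zero , j) (one , next j) (one , z) (begin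
      prismDist (zero , j) (one , z)      ≡⟨ prismDist-otherLayer {zero} {one} j z (λ ()) ⟩
      suc (cycleDistF j z)                ≡⟨ sym viaPrevious ⟩
      cycleDistF (next j) z               ≡⟨ sym (prismDist-sameLayer one (next j) z) ⟩
      prismDist (one , next j) (one , z)  ∎))
      where
      open ≡-Reasoning
      viaPrevious : cycleDistF (next j) z ≡ suc (cycleDistF j z)
      viaPrevious = cycleDist-via-predecessor (toℕ<n j) (toℕ<n (next j)) (toℕ<n z) t+1≤m (next-shift j) zp

module PrismFractionalDimension (m : ℕ) (1≤m : 1 Data.Nat.≤ m) where

  open Counting using (count)
  open Weights
  open Resolving m 1≤m
  open import Data.Nat as ℕ using (ℕ; zero; suc; z≤n; s≤s)
  import Data.Nat.Properties as ℕ
  open import Data.Nat.Tactic.RingSolver using (solve-∀)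
  open import Data.Integer using (+_)
  open import Data.Rational using (ℚ; 0ℚ; 1ℚ; _*_; _≤_; _/_; nonNegative)
  open import Data.Rational.Properties
    using ( *-monoʳ-≤-nonNeg; *-cancelˡ-≤-pos; *-identityˡ; normalize-nonNeg; normalize-pos; nonNegative⁻¹
          ; module ≤-Reasoning )
  open import Data.Fin using (zero)
  open import Data.List using (length; filter; allFin)
  open import Data.Product using (_,_; proj₁)
  open import Function using (_∘_)
  open import Relation.Binary.PropositionalEquality using (_≡_; _≢_; sym; cong; module ≡-Reasoning)

  dimension : ℚ
  dimension = (+ (2 ℕ.* n)) / suc n

  uniform : V → ℚ
  uniform _ = (+ 1) / suc n

  uniform-resolving : IsResolvingFunction Prism uniform
  uniform-resolving = (λ _ → 0≤c , c≤1) , separates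
    where
    open ≤-Reasoning
    c : ℚ
    c = (+ 1) / suc n
    0≤c : 0ℚ ≤ c
    0≤c = nonNegative⁻¹ c {{normalize-nonNeg 1 (suc n)}}
    [n+1]c≡1 : fromℕ (suc n) * c ≡ 1ℚ
    [n+1]c≡1 = fromℕ-*-/ (suc n) 1 n 1 0 (x·1·1≡1·x (suc n))
      where
      x·1·1≡1·x : ∀ x → x ℕ.* 1 ℕ.* 1 ≡ 1 ℕ.* x
      x·1·1≡1·x = solve-∀
    c≤1 : c ≤ 1ℚ
    c≤1 = begin
      c                 ≡⟨ sym (*-identityˡ c) ⟩
      1ℚ * c            ≤⟨ *-monoʳ-≤-nonNeg c {{nonNegative 0≤c}} (fromℕ-mono-≤ {1} {suc n} (s≤s z≤n)) ⟩
      fromℕ (suc n) * c ≡⟨ [n+1]c≡1 ⟩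
      1ℚ                ∎
    separates : ∀ x y → x ≢ y → 1ℚ ≤ weightR Prism uniform x y
    separates x y x≢y = begin
      1ℚ                                              ≡⟨ sym [n+1]c≡1 ⟩
      fromℕ (suc n) * c                               ≤⟨ *-monoʳ-≤-nonNeg c {{nonNegative 0≤c}} n+1≤#resolvers ⟩
      fromℕ (count (resolves? x y) (verts Prism)) * c ≡⟨ sym (sumℚ-const c (filter (resolves? x y) (verts Prism))) ⟩
      weightR Prism uniform x y                       ∎
      where
      n+1≤#resolvers : fromℕ (suc n) ≤ fromℕ (count (resolves? x y) (verts Prism))
      n+1≤#resolvers = fromℕ-mono-≤ (#resolvers>n x y x≢y)

  uniform-total : totalWeight Prism uniform ≡ dimension
  uniform-total = begin
    sumℚ uniform (verts Prism)                     ≡⟨ sumℚ-const ((+ 1) / suc n) (verts Prism) ⟩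
    fromℕ (length (verts Prism)) * ((+ 1) / suc n) ≡⟨ cong (λ k → fromℕ k * ((+ 1) / suc n)) length-vertices ⟩
    fromℕ (2 ℕ.* n) * ((+ 1) / suc n)              ≡⟨ fromℕ-*-/ (2 ℕ.* n) 1 n (2 ℕ.* n) n 2n·1·[n+1]≡2n·[n+1] ⟩
    dimension                                      ∎
    where
    open ≡-Reasoning
    2n·1·[n+1]≡2n·[n+1] : 2 ℕ.* n ℕ.* 1 ℕ.* suc n ≡ 2 ℕ.* n ℕ.* suc n
    2n·1·[n+1]≡2n·[n+1] = cong (ℕ._* suc n) (ℕ.*-identityʳ (2 ℕ.* n))

  lower-bound : ∀ f → IsResolvingFunction Prism f → dimension ≤ totalWeight Prism f
  lower-bound f (bounded , resolving) = *-cancelˡ-≤-pos (fromℕ (suc m)) {{normalize-pos (suc m) 1}} (begin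
    fromℕ (suc m) * dimension
      ≡⟨ fromℕ-*-/ (suc m) (2 ℕ.* n) n n 0 ([m+1]·2n≡n·[n+1] m) ⟩
    fromℕ n
      ≡⟨ cong fromℕ (sym length-allFin) ⟩
    fromℕ (length (allFin n))
      ≤⟨ fromℕ-length≤sumℚ (λ j → resolving (zero , j) (one , next j) (λ ())) (allFin n) ⟩
    sumℚ (λ j → weightR Prism f (zero , j) (one , next j)) (allFin n)
      ≤⟨ double-counting (λ j → resolves? (zero , j) (one , next j)) (suc m) (allFin n) (verts Prism)
                         (proj₁ ∘ bounded) #resolvedTwistedPairs≤m+1 ⟩
    fromℕ (suc m) * totalWeight Prism f
      ∎)
    where
    open ≤-Reasoning
    [m+1]·2n≡n·[n+1] : ∀ m → suc m ℕ.* (2 ℕ.* suc (m ℕ.+ m)) ℕ.* 1 ≡ suc (m ℕ.+ m) ℕ.* suc (suc (m ℕ.+ m))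
    [m+1]·2n≡n·[n+1] = solve-∀

  prism-fractionalDimension : FracMetricDim≡ Prism dimension
  prism-fractionalDimension = (uniform , uniform-resolving , uniform-total) , lower-bound

open import Data.Nat using (zero; suc; _+_; _*_; _%_; _≤_; z≤n; s≤s) renaming (_/_ to _div_)
open import Data.Nat.DivMod using (m≡m%n+[m/n]*n)
open import Data.Nat.Tactic.RingSolver using (solve-∀)
open import Data.Integer using (+_)
open import Data.Product using (∃; _,_)
open import Data.Rational using (_/_)
open import Relation.Binary.PropositionalEquality using (_≡_; refl; trans; cong₂)

odd⇒≡suc-double : ∀ n → n % 2 ≡ 1 → ∃ λ h → n ≡ suc (h + h)
odd⇒≡suc-double n odd = n div 2 , trans (m≡m%n+[m/n]*n n 2) (cong₂ _+_ odd (x·2≡x+x (n div 2)))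
  where
  x·2≡x+x : ∀ x → x * 2 ≡ x + x
  x·2≡x+x = solve-∀

3≤suc-double⇒1≤ : ∀ {h} → 3 ≤ suc (h + h) → 1 ≤ h
3≤suc-double⇒1≤ {zero} (s≤s ())
3≤suc-double⇒1≤ {suc h} _ = s≤s z≤n

theorem2p3 : (n : ℕ) → n % 2 ≡ 1 → 3 ≤ n →
    FracMetricDim≡ (K₂ □ C n) ((+ (2 * n)) / (suc n))
theorem2p3 n odd 3≤n with odd⇒≡suc-double n odd
... | h , refl = PrismFractionalDimension.prism-fractionalDimension h (3≤suc-double⇒1≤ 3≤n)
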